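{- Fix a code retrieving function $\rho$ (all triples below are w.r.t. $\rho$). Let $G$ be a reflexive state relation and assume (1) $\models\{R,P\}\,p\,\{S,G\}$, (2) $\models\{R,S\}\,q\,\{Q,G\}$, (3) if $q=\mathbf{skip}$ then $R(Q)\subseteq Q$. Then $\models\{R,P\}\,p;q\,\{Q,G\}$.
   Context: Program terms over a state type $\alpha$ are generated by $p::=\mathbf{skip}\mid\mathbf{basic}\,f\mid\mathbf{cjump}\,C\,i\,p\mid\mathbf{while}\,C\,p\,p\mid\mathbf{if}\,C\,p\,p\mid p;p\mid\Vert(p_1,\dots,p_m)\mid\mathbf{await}\,C\,p$ ($f:\alpha\to\alpha$, $C\subseteq\alpha$, $i\in\mathbb N$, $m\ge1$). A code retrieving function $\rho$ maps $\mathbb N$ to terms. The program step relation $\rho\vdash(p,\sigma)\to_{\mathcal P}(p',\sigma')$ is the least relation with: $(\mathbf{basic}\,f,\sigma)\to(\mathbf{skip},f\sigma)$; $(\mathbf{cjump}\,C\,i\,p,\sigma)\to(\rho\,i,\sigma)$ if $\sigma\in C$, $\to(p,\sigma)$ otherwise; $(\mathbf{await}\,C\,p,\sigma)\to(\mathbf{skip},\sigma')$ if $\sigma\in C$ and $(p,\sigma)\to^*(\mathbf{skip},\sigma')$; $(\mathbf{if}\,C\,p_1\,p_2,\sigma)\to(p_1,\sigma)$ if $\sigma\in C$, $\to(p_2,\sigma)$ otherwise; for $x=\mathbf{while}\,C\,p_1\,p_2$: $(x,\sigma)\to(p_1;(\mathbf{skip};x),\sigma)$ if $\sigma\in C$,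 $\to(p_2,\sigma)$ otherwise; $(p_1;p_2,\sigma)\to(p_1';p_2,\sigma')$ if $(p_1,\sigma)\to(p_1',\sigma')$; $(\mathbf{skip};p,\sigma)\to(p,\sigma)$; $(\Vert(\dots,p_i,\dots),\sigma)\to(\Vert(\dots,p_i',\dots),\sigma')$ if $(p_i,\sigma)\to(p_i',\sigma')$; $(\Vert(\mathbf{skip},\dots,\mathbf{skip}),\sigma)\to(\mathbf{skip},\sigma)$. A finite potential computation of $(\rho,p)$ is a nonempty finite sequence $(p_0,\sigma_0),\dots,(p_{n-1},\sigma_{n-1})$ with $p_0=p$ where each transition is a program step or an environment step ($p_{i+1}=p_i$, state arbitrary). For state relations $R,G\subseteq\alpha\times\alpha$ and state predicates $P,Q\subseteq\alpha$, $\models\{R,P\}\,p\,\{Q,G\}$ means: every finite potential computation of $(\rho,p)$ with $\sigma_0\in P$ and $(\sigma_i,\sigma_{i+1})\in R$ for all environment steps has $(\sigma_i,\sigma_{i+1})\in G$ for all program steps and, if some $p_i=\mathbf{skip}$, $\sigma_i\in Q$ for the least such $i$. $R(X)=\{b\mid\exists a\in X.(a,b)\in R\}$. -}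

module Defs where

open import Data.Nat using (ℕ; zero; suc)
open import Data.Fin using (Fin; zero; suc; inject₁; _<_)
open import Data.Vec using (Vec; lookup; _[_]≔_)
open import Data.Vec.Relation.Unary.All using (All)
open import Data.Product using (_×_; _,_; proj₁; proj₂)
open import Data.Unit using (⊤)
open import Data.Empty using (⊥)
open import Relation.Binary.PropositionalEquality using (_≡_; _≢_)
open import Relation.Binary.Construct.Closure.ReflexiveTransitive using (Star)

data Prog (α : Set) : Set₁ where
  skip  : Prog α
  basic : (α → α) → Prog α
  cjump : (α → Set) → ℕ → Prog α → Prog α
  while : (α → Set) → Prog α → Prog α → Prog α
  if′   : (α → Set) → Prog α → Prog α → Prog α
  _⨾_   : Prog α → Prog α → Prog α
  par   : ∀ {m} → Vec (Prog α) (suc m) → Prog α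
  await : (α → Set) → Prog α → Prog α

CodeRet : Set → Set₁
CodeRet α = ℕ → Prog α

Conf : Set → Set₁
Conf α = Prog α × α

data Step {α : Set} (ρ : CodeRet α) : Conf α → Conf α → Set₁ where
  basicS  : ∀ {f σ} → Step ρ (basic f , σ) (skip , f σ)
  cjumpT  : ∀ {C i p σ} → C σ → Step ρ (cjump C i p , σ) (ρ i , σ)
  cjumpF  : ∀ {C i p σ} → (C σ → ⊥) → Step ρ (cjump C i p , σ) (p , σ)
  awaitS  : ∀ {C p σ σ'} → C σ → Star (Step ρ) (p , σ) (skip , σ')
          → Step ρ (await C p , σ) (skip , σ')
  ifT     : ∀ {C p₁ p₂ σ} → C σ → Step ρ (if′ C p₁ p₂ , σ) (p₁ , σ)
  ifF     : ∀ {C p₁ p₂ σ} → (C σ → ⊥) → Step ρ (if′ C p₁ p₂ , σ) (p₂ , σ)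
  whileT  : ∀ {C p₁ p₂ σ} → C σ
          → Step ρ (while C p₁ p₂ , σ) ((p₁ ⨾ (skip ⨾ while C p₁ p₂)) , σ)
  whileF  : ∀ {C p₁ p₂ σ} → (C σ → ⊥) → Step ρ (while C p₁ p₂ , σ) (p₂ , σ)
  seqS    : ∀ {p₁ p₁' p₂ σ σ'} → Step ρ (p₁ , σ) (p₁' , σ')
          → Step ρ ((p₁ ⨾ p₂) , σ) ((p₁' ⨾ p₂) , σ')
  seqSkip : ∀ {p σ} → Step ρ ((skip ⨾ p) , σ) (p , σ)
  parS    : ∀ {m} {ps : Vec (Prog α) (suc m)} (i : Fin (suc m)) {p' σ σ'}
          → Step ρ (lookup ps i , σ) (p' , σ')
          → Step ρ (par ps , σ) (par (ps [ i ]≔ p') , σ')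
  parSkip : ∀ {m} {ps : Vec (Prog α) (suc m)} {σ} → All (_≡ skip) ps
          → Step ρ (par ps , σ) (skip , σ)

data Trans {α : Set} (ρ : CodeRet α) : Conf α → Conf α → Set₁ where
  ctran : ∀ {c c'} → Step ρ c c' → Trans ρ c c'
  etran : ∀ {p σ σ'} → Trans ρ (p , σ) (p , σ')

-- Finite potential computation of (ρ, p): configurations cs 0 … cs n
-- (length n+1 ≥ 1) with cs 0 having program p, and a transition between
-- each consecutive pair.
record Comp {α : Set} (ρ : CodeRet α) (p : Prog α) : Set₁ where
  field
    len   : ℕ
    confs : Fin (suc len) → Conf α
    start : proj₁ (confs zero) ≡ p
    trans : (i : Fin len) → Trans ρ (confs (inject₁ i)) (confs (suc i))

EnvOK : ∀ {α : Set} {ρ : CodeRet α} {c c'} → (α → α → Set) → Trans ρ c c' → Set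
EnvOK R (ctran _) = ⊤
EnvOK R (etran {σ = σ} {σ' = σ'}) = R σ σ'

ProgOK : ∀ {α : Set} {ρ : CodeRet α} {c c'} → (α → α → Set) → Trans ρ c c' → Set
ProgOK G (ctran {c = c} {c' = c'} _) = G (proj₂ c) (proj₂ c')
ProgOK G etran = ⊤

Valid : ∀ {α : Set} (ρ : CodeRet α) (R : α → α → Set) (P : α → Set)
        (p : Prog α) (Q : α → Set) (G : α → α → Set) → Set₁
Valid ρ R P p Q G =
  (c : Comp ρ p) →
  P (proj₂ (Comp.confs c zero)) →
  ((i : Fin (Comp.len c)) → EnvOK R (Comp.trans c i)) →
  ((i : Fin (Comp.len c)) → ProgOK G (Comp.trans c i))
  × ((i : Fin (suc (Comp.len c))) → proj₁ (Comp.confs c i) ≡ skip →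
       ((j : Fin (suc (Comp.len c))) → j < i → proj₁ (Comp.confs c j) ≢ skip) →
       Q (proj₂ (Comp.confs c i)))

module Submission where

-- Potential computations are given in Defs as Fin-indexed sequences, which
-- are awkward to cut into pieces.  We therefore first recast validity in
-- terms of inductive runs: a Run c d is a list of transitions from c to d
-- whose environment steps lie in R.  For such a run, Guar says that every
-- program step is a G-step and Post Q says that the first skip configuration
-- (if any) satisfies Q; a configuration is Safe for Q if every run from it
-- has both properties.  Translating runs to computations and back shows that
--   ⊨ {R,P} p {Q,G}  ⟺  every (p , σ) with σ ∈ P is Safe for Q.
-- Safety is preserved by the steps of a non-terminated program and, for q,
-- by environment steps (using R(Q) ⊆ Q when q = skip).  Walking along a run
-- of p';q then shows that Safe S (p',σ) implies Safe Q (p';q , σ): while p'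
-- runs, steps of p';q are steps of p'; when p' becomes skip its state is in
-- S, so q is safe from there on, and the step skip;q → q is a G-step by
-- reflexivity of G.  The theorem is this fact for the start configurations.

open import Defs
open import Data.Nat using (ℕ; zero; suc; s≤s; z≤n)
open import Data.Fin using (Fin; zero; suc; inject₁; fromℕ; _<_)
open import Data.Product using (_×_; _,_; proj₁; proj₂)
open import Data.Unit using (⊤; tt)
open import Data.Empty using (⊥-elim)
open import Relation.Nullary using (Dec; yes; no)
open import Relation.Binary.PropositionalEquality using (_≡_; _≢_; refl)

isSkip? : ∀ {α : Set} (p : Prog α) → Dec (p ≡ skip)
isSkip? skip          = yes refl
isSkip? (basic _)     = no λ ()
isSkip? (cjump _ _ _) = no λ ()
isSkip? (while _ _ _) = no λ ()
isSkip? (if′ _ _ _)   = no λ ()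
isSkip? (_ ⨾ _)       = no λ ()
isSkip? (par _)       = no λ ()
isSkip? (await _ _)   = no λ ()

module Runs {α : Set} (ρ : CodeRet α) (R G : α → α → Set) where

  data Run : Conf α → Conf α → Set₁ where
    []     : ∀ {c} → Run c c
    _∷⟨_⟩_ : ∀ {c c' d} (t : Trans ρ c c') → EnvOK R t → Run c' d → Run c d

  Guar : ∀ {c d} → Run c d → Set
  Guar []           = ⊤
  Guar (t ∷⟨ _ ⟩ r) = ProgOK G t × Guar r

  data Post (Q : α → Set) : ∀ {c d} → Run c d → Set₁ where
    reached : ∀ {c d} {r : Run c d} → proj₁ c ≡ skip → Q (proj₂ c) → Post Q r
    never   : ∀ {c} → proj₁ c ≢ skip → Post Q ([] {c})
    later   : ∀ {c c' d} {t : Trans ρ c c'} {e : EnvOK R t} {r : Run c' d}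
            → proj₁ c ≢ skip → Post Q r → Post Q (t ∷⟨ e ⟩ r)

  post-head : ∀ {Q c d} {r : Run c d} → Post Q r → proj₁ c ≡ skip → Q (proj₂ c)
  post-head (reached _ q)    _      = q
  post-head (never c≢skip)   c-skip = ⊥-elim (c≢skip c-skip)
  post-head (later c≢skip _) c-skip = ⊥-elim (c≢skip c-skip)

  Safe : (α → Set) → Conf α → Set₁
  Safe Q c = ∀ {d} (r : Run c d) → Guar r × Post Q r

  extendGood : ∀ {Q c c' d} {t : Trans ρ c c'} {e : EnvOK R t} {r : Run c' d}
             → proj₁ c ≢ skip → ProgOK G t → Guar r × Post Q r
             → Guar (t ∷⟨ e ⟩ r) × Post Q (t ∷⟨ e ⟩ r)
  extendGood c≢skip g (guar , post) = (g , guar) , later c≢skip post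

  lengthR : ∀ {c d} → Run c d → ℕ
  lengthR []           = zero
  lengthR (_ ∷⟨ _ ⟩ r) = suc (lengthR r)

  confsR : ∀ {c d} (r : Run c d) → Fin (suc (lengthR r)) → Conf α
  confsR {c} r           zero    = c
  confsR (_ ∷⟨ _ ⟩ r) (suc i) = confsR r i

  transR : ∀ {c d} (r : Run c d) (i : Fin (lengthR r))
         → Trans ρ (confsR r (inject₁ i)) (confsR r (suc i))
  transR (t ∷⟨ _ ⟩ _) zero    = t
  transR (_ ∷⟨ _ ⟩ r) (suc i) = transR r i

  envR : ∀ {c d} (r : Run c d) (i : Fin (lengthR r)) → EnvOK R (transR r i)
  envR (_ ∷⟨ e ⟩ _) zero    = e
  envR (_ ∷⟨ _ ⟩ r) (suc i) = envR r i

  asComp : ∀ {p σ d} → Run (p , σ) d → Comp ρ p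
  asComp r = record { len = lengthR r ; confs = confsR r ; start = refl ; trans = transR r }

  asRun : (n : ℕ) (f : Fin (suc n) → Conf α)
          (tr : (i : Fin n) → Trans ρ (f (inject₁ i)) (f (suc i)))
        → ((i : Fin n) → EnvOK R (tr i)) → Run (f zero) (f (fromℕ n))
  asRun zero    f tr env = []
  asRun (suc n) f tr env =
    tr zero ∷⟨ env zero ⟩ asRun n (λ i → f (suc i)) (λ i → tr (suc i)) (λ i → env (suc i))

  -- The two clauses of the conclusion of Valid, for a sequence of
  -- configurations f connected by transitions tr.
  GuarAt : ∀ n (f : Fin (suc n) → Conf α)
         → ((i : Fin n) → Trans ρ (f (inject₁ i)) (f (suc i))) → Set
  GuarAt n f tr = (i : Fin n) → ProgOK G (tr i)

  PostAt : (α → Set) → ∀ n → (Fin (suc n) → Conf α) → Set₁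
  PostAt Q n f = (i : Fin (suc n)) → proj₁ (f i) ≡ skip →
                   ((j : Fin (suc n)) → j < i → proj₁ (f j) ≢ skip) → Q (proj₂ (f i))

  guarAt⇒guar : ∀ {c d} (r : Run c d) → GuarAt (lengthR r) (confsR r) (transR r) → Guar r
  guarAt⇒guar []           h = tt
  guarAt⇒guar (_ ∷⟨ _ ⟩ r) h = h zero , guarAt⇒guar r (λ i → h (suc i))

  postAt⇒post : ∀ {Q c d} (r : Run c d) → PostAt Q (lengthR r) (confsR r) → Post Q r
  postAt⇒post {c = p , _} r h with isSkip? p
  ... | yes p≡skip = reached p≡skip (h zero p≡skip λ _ ())
  postAt⇒post []               h | no p≢skip = never p≢skip
  postAt⇒post {Q} (_ ∷⟨ _ ⟩ r) h | no p≢skip = later p≢skip (postAt⇒post r shifted)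
    where
      shifted : PostAt Q (lengthR r) (confsR r)
      shifted i i-skip before = h (suc i) i-skip λ where
        zero    _         → p≢skip
        (suc j) (s≤s j<i) → before j j<i

  guar⇒guarAt : ∀ n f tr env → Guar (asRun n f tr env) → GuarAt n f tr
  guar⇒guarAt (suc n) f tr env (g , _)    zero    = g
  guar⇒guarAt (suc n) f tr env (_ , guar) (suc i) =
    guar⇒guarAt n (λ i → f (suc i)) (λ i → tr (suc i)) (λ i → env (suc i)) guar i

  post⇒postAt : ∀ {Q} n f tr env → Post Q (asRun n f tr env) → PostAt Q n f
  post⇒postAt n       f tr env post                zero    f₀-skip _      = post-head post f₀-skip
  post⇒postAt (suc n) f tr env (reached f₀-skip _) (suc i) _       before =
    ⊥-elim (before zero (s≤s z≤n) f₀-skip)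
  post⇒postAt (suc n) f tr env (later _ post)      (suc i) i-skip  before =
    post⇒postAt n (λ i → f (suc i)) (λ i → tr (suc i)) (λ i → env (suc i)) post i i-skip
      λ j j<i → before (suc j) (s≤s j<i)

  valid⇒safe : ∀ {P p Q} → Valid ρ R P p Q G → ∀ {σ} → P σ → Safe Q (p , σ)
  valid⇒safe valid pre r with valid (asComp r) pre (envR r)
  ... | guarAt , postAt = guarAt⇒guar r guarAt , postAt⇒post r postAt

  safe⇒valid : ∀ {P p Q} → (∀ {σ} → P σ → Safe Q (p , σ)) → Valid ρ R P p Q G
  safe⇒valid {P} {p} {Q} safe c pre env =
    guar⇒guarAt len confs trans env guar , post⇒postAt len confs trans env post
    where
      open Comp c
      -- the start program of a computation is only given up to equality
      safeFrom : ∀ {p' σ} → p' ≡ p → P σ → Safe Q (p' , σ)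
      safeFrom refl = safe
      run : Run (confs zero) (confs (fromℕ len))
      run = asRun len confs trans env
      guar : Guar run
      guar = proj₁ (safeFrom start pre run)
      post : Post Q run
      post = proj₂ (safeFrom start pre run)

  safe-skip : ∀ {Q σ} → Safe Q (skip , σ) → Q σ
  safe-skip safe = post-head (proj₂ (safe [])) refl

  safe-guar : ∀ {Q c c'} → Safe Q c → (t : Trans ρ c c') → EnvOK R t → ProgOK G t
  safe-guar safe t e = proj₁ (proj₁ (safe (t ∷⟨ e ⟩ [])))

  safe-next : ∀ {Q c c'} → proj₁ c ≢ skip → Safe Q c
            → (t : Trans ρ c c') → EnvOK R t → Safe Q c'
  safe-next c≢skip safe t e r with safe (t ∷⟨ e ⟩ r)
  ... | _          , reached c-skip _ = ⊥-elim (c≢skip c-skip)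
  ... | (_ , guar) , later _ post     = guar , post

  safe-env : ∀ {Q q σ σ'} → (q ≡ skip → ∀ σ σ' → Q σ → R σ σ' → Q σ')
           → Safe Q (q , σ) → R σ σ' → Safe Q (q , σ')
  safe-env {q = q} stable safe e r with isSkip? q
  ... | no q≢skip = safe-next q≢skip safe etran e r
  ... | yes refl  = proj₂ (proj₁ (safe (etran ∷⟨ e ⟩ r)))
                  , reached refl (stable refl _ _ (safe-skip safe) e)

  module Sequential (S Q : α → Set) (q : Prog α) (G-refl : ∀ σ → G σ σ)
    (q-safe : ∀ {σ} → S σ → Safe Q (q , σ))
    (stable : q ≡ skip → ∀ σ σ' → Q σ → R σ σ' → Q σ') where

    safe-skip⨾ : ∀ {σ} → Safe Q (q , σ) → Safe Q (skip ⨾ q , σ)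
    safe-skip⨾ safe []                         = tt , never λ ()
    safe-skip⨾ safe (ctran (seqS ()) ∷⟨ _ ⟩ _)
    safe-skip⨾ safe (ctran seqSkip ∷⟨ _ ⟩ r)   = extendGood (λ ()) (G-refl _) (safe r)
    safe-skip⨾ safe (etran ∷⟨ e ⟩ r)           =
      extendGood (λ ()) tt (safe-skip⨾ (safe-env stable safe e) r)

    safe-⨾ : ∀ {p σ} → Safe S (p , σ) → Safe Q (p ⨾ q , σ)
    safe-⨾ {p} safe r with isSkip? p
    ... | yes refl = safe-skip⨾ (q-safe (safe-skip safe)) r
    safe-⨾ safe []                        | no p≢skip = tt , never λ ()
    safe-⨾ safe (ctran (seqS s) ∷⟨ _ ⟩ r) | no p≢skip =
      extendGood (λ ()) (safe-guar safe (ctran s) tt)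
        (safe-⨾ (safe-next p≢skip safe (ctran s) tt) r)
    safe-⨾ safe (ctran seqSkip ∷⟨ _ ⟩ _)  | no p≢skip = ⊥-elim (p≢skip refl)
    safe-⨾ safe (etran ∷⟨ e ⟩ r)          | no p≢skip =
      extendGood (λ ()) tt (safe-⨾ (safe-next p≢skip safe etran e) r)

mainTheorem3 : {α : Set} (ρ : CodeRet α) (R G : α → α → Set) (P S Q : α → Set)
    (p q : Prog α) →
    (∀ σ → G σ σ) →
    Valid ρ R P p S G →
    Valid ρ R S q Q G →
    (q ≡ skip → ∀ σ σ' → Q σ → R σ σ' → Q σ') →
    Valid ρ R P (p ⨾ q) Q G
mainTheorem3 ρ R G P S Q p q G-refl p-valid q-valid stable =
  safe⇒valid {P} λ pre → safe-⨾ (valid⇒safe p-valid pre)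
  where
    open Runs ρ R G
    open Sequential S Q q G-refl (valid⇒safe {S} q-valid) stable
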